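{- Let $G=(L,R,E)$ be an $(n-2)$-regular bipartite graph with sides $L$ and $R$ satisfying $|L|=|R|=n\ge 6$, and let $M$ be a path of length $3$ (i.e. with three edges) in $G$. Then $G$ has a $2$-factor containing the three edges of $M$.
   Context: A $2$-factor of a graph is a spanning subgraph in which every vertex has degree exactly $2$. -}

module Defs where

open import Data.Nat using (ℕ; zero; suc)
open import Data.Fin using (Fin; zero; suc)
open import Data.Bool using (Bool; true; false)
open import Relation.Binary.PropositionalEquality using (_≡_)
open import Data.Product using (_×_)
open import Data.Empty using (⊥)

count : ∀ {n} → (Fin n → Bool) → ℕ
count {zero} p = 0
count {suc n} p with p zero
... | true  = suc (count (λ i → p (suc i)))
... | false = count (λ i → p (suc i))

-- A (simple) bipartite graph with sides L = Fin n and R = Fin n,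
-- given by its biadjacency relation: E l r ≡ true iff l ~ r.
BipGraph : ℕ → Set
BipGraph n = Fin n → Fin n → Bool

degL : ∀ {n} → BipGraph n → Fin n → ℕ
degL E l = count (λ r → E l r)

degR : ∀ {n} → BipGraph n → Fin n → ℕ
degR E r = count (λ l → E l r)

Regular : ∀ {n} → ℕ → BipGraph n → Set
Regular {n} d E = (∀ (l : Fin n) → degL E l ≡ d) × (∀ (r : Fin n) → degR E r ≡ d)

Subgraph : ∀ {n} → BipGraph n → BipGraph n → Set
Subgraph {n} F E = ∀ (l r : Fin n) → F l r ≡ true → E l r ≡ true

TwoFactor : ∀ {n} → BipGraph n → BipGraph n → Set
TwoFactor F E = Subgraph F E × Regular 2 F

-- In a bipartite graph every 3-edge path alternates sides and its
-- endpoints lie on opposite sides, so up to naming it has this shape.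
record Path3 {n} (E : BipGraph n) : Set where
  field
    l₁ l₂ r₁ r₂ : Fin n
    l₁≢l₂ : l₁ ≡ l₂ → ⊥
    r₁≢r₂ : r₁ ≡ r₂ → ⊥
    e₁ : E l₁ r₁ ≡ true
    e₂ : E l₂ r₁ ≡ true
    e₃ : E l₂ r₂ ≡ true

ContainsPath : ∀ {n} {E : BipGraph n} → BipGraph n → Path3 E → Set
ContainsPath F P = F l₁ r₁ ≡ true × F l₂ r₁ ≡ true × F l₂ r₂ ≡ true
  where open Path3 P

-- Every vertex of E misses exactly two vertices of the other side, and removing a perfect
-- matching from E leaves a graph in which every vertex misses three.  In such a dense bipartite
-- graph a perfect matching with prescribed edges is found by local search over permutations f:
-- while some l is sent to a non-neighbour, exchange f l with f l′ for an l′ with l ~ f l′ and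
-- l′ ~ f l.  If every vertex misses at most d vertices, fewer than 2d choices of l′ fail this,
-- so for d = 2 and n ≥ 6 a partner exists even after excluding two prescribed vertices, and the
-- number of misplaced vertices drops.  A perfect matching f₁ of E through l₁r₁ and l₂r₂ and a perfect
-- matching f₂ of E ∖ f₁ through l₂r₁ are disjoint, so their union is the required 2-factor.

module Submission where

open import Defs
open import Data.Nat using (ℕ; zero; suc; _+_; _∸_; _≤_; _<_; z≤n; s≤s)
open import Data.Nat.Properties hiding (_≟_)
open import Data.Fin using (Fin; zero; suc)
open import Data.Fin.Properties using (_≟_; any?)
open import Data.Fin.Permutation using (Permutation; _⟨$⟩ʳ_; _⟨$⟩ˡ_; _∘ₚ_; id; transpose; inverseʳ)
open import Data.Bool using (Bool; true; false; _∧_; _∨_; not)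
import Data.Bool.Properties as Bool
open import Data.Product using (Σ; ∃; _×_; _,_; proj₁; proj₂)
open import Data.Sum using (_⊎_; inj₁; inj₂)
open import Data.Empty using (⊥; ⊥-elim)
open import Function using (_∘_)
open import Relation.Nullary using (Dec; yes; no; does)
open import Relation.Nullary.Decidable using (dec-true; dec-false; _×-dec_)
open import Relation.Binary.PropositionalEquality
open import Algebra.Properties.CommutativeMonoid.Sum +-0-commutativeMonoid
  using (sum; sum-cong-≗; ∑-distrib-+; ∑-permute)

-- Counting

true≢false : ∀ {b} → b ≡ true → b ≡ false → ⊥
true≢false refl ()

_==_ : ∀ {n} → Fin n → Fin n → Bool
i == j = does (i ≟ j)

==-refl : ∀ {n} (i : Fin n) → (i == i) ≡ true
==-refl i = dec-true (i ≟ i) refl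

==⇒≡ : ∀ {n} {i j : Fin n} → (i == j) ≡ true → i ≡ j
==⇒≡ {i = i} {j} eq with i ≟ j
... | yes i≡j = i≡j

≢⇒==false : ∀ {n} {i j : Fin n} → i ≢ j → (i == j) ≡ false
≢⇒==false {i = i} {j} = dec-false (i ≟ j)

==false⇒≢ : ∀ {n} {i j : Fin n} → (i == j) ≡ false → i ≢ j
==false⇒≢ {i = i} eq refl with () ← trans (sym (==-refl i)) eq

indicator : Bool → ℕ
indicator true  = 1
indicator false = 0

count≡sum : ∀ {n} (p : Fin n → Bool) → count p ≡ sum (indicator ∘ p)
count≡sum {zero}  p = refl
count≡sum {suc n} p with p zero
... | true  = cong suc (count≡sum (p ∘ suc))
... | false = count≡sum (p ∘ suc)

count-cong : ∀ {n} (p q : Fin n → Bool) → (∀ i → p i ≡ q i) → count p ≡ count q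
count-cong p q p≗q = begin
  count p              ≡⟨ count≡sum p ⟩
  sum (indicator ∘ p)  ≡⟨ sum-cong-≗ (cong indicator ∘ p≗q) ⟩
  sum (indicator ∘ q)  ≡⟨ count≡sum q ⟨
  count q              ∎
  where open ≡-Reasoning

count-permute : ∀ {n} (p : Fin n → Bool) (π : Permutation n n) →
                count (p ∘ (π ⟨$⟩ʳ_)) ≡ count p
count-permute p π = begin
  count (p ∘ (π ⟨$⟩ʳ_))                ≡⟨ count≡sum (p ∘ (π ⟨$⟩ʳ_)) ⟩
  sum (indicator ∘ p ∘ (π ⟨$⟩ʳ_))      ≡⟨ ∑-permute (indicator ∘ p) π ⟨
  sum (indicator ∘ p)                  ≡⟨ count≡sum p ⟨
  count p                              ∎
  where open ≡-Reasoning

count-+ : ∀ {n} (p q r s : Fin n → Bool) →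
          (∀ i → indicator (p i) + indicator (q i) ≡ indicator (r i) + indicator (s i)) →
          count p + count q ≡ count r + count s
count-+ p q r s pointwise = begin
  count p + count q                            ≡⟨ cong₂ _+_ (count≡sum p) (count≡sum q) ⟩
  sum (indicator ∘ p) + sum (indicator ∘ q)    ≡⟨ ∑-distrib-+ (indicator ∘ p) (indicator ∘ q) ⟨
  sum (λ i → indicator (p i) + indicator (q i)) ≡⟨ sum-cong-≗ pointwise ⟩
  sum (λ i → indicator (r i) + indicator (s i)) ≡⟨ ∑-distrib-+ (indicator ∘ r) (indicator ∘ s) ⟩
  sum (indicator ∘ r) + sum (indicator ∘ s)    ≡⟨ cong₂ _+_ (count≡sum r) (count≡sum s) ⟨
  count r + count s                            ∎
  where open ≡-Reasoning

count-false : ∀ {n} → count {n} (λ _ → false) ≡ 0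
count-false {zero}  = refl
count-false {suc n} = count-false {n}

count-true : ∀ {n} → count {n} (λ _ → true) ≡ n
count-true {zero}  = refl
count-true {suc n} = cong suc (count-true {n})

count-pos : ∀ {n} (p : Fin n → Bool) {j} → p j ≡ true → 0 < count p
count-pos {suc n} p {zero}  pj rewrite pj = s≤s z≤n
count-pos {suc n} p {suc j} pj with p zero
... | true  = s≤s z≤n
... | false = count-pos (p ∘ suc) pj

count-==ˡ : ∀ {n} (a : Fin n) → count (_== a) ≡ 1
count-==ˡ {suc n} zero    =
  cong suc (trans (count-cong {n} (λ i → suc i == zero) (λ _ → false) (λ _ → refl)) (count-false {n}))
count-==ˡ {suc n} (suc a) =
  trans (count-cong (λ i → suc i == suc a) (_== a) (λ _ → refl)) (count-==ˡ a)

count-==ʳ : ∀ {n} (a : Fin n) → count (a ==_) ≡ 1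
count-==ʳ {suc n} zero    =
  cong suc (trans (count-cong {n} (λ i → zero == suc i) (λ _ → false) (λ _ → refl)) (count-false {n}))
count-==ʳ {suc n} (suc a) =
  trans (count-cong (λ i → suc a == suc i) (a ==_) (λ _ → refl)) (count-==ʳ a)

count-∨-∧ : ∀ {n} (p q : Fin n → Bool) →
            count (λ i → p i ∨ q i) + count (λ i → p i ∧ q i) ≡ count p + count q
count-∨-∧ p q = count-+ _ _ p q λ i → pointwise (p i) (q i)
  where
  pointwise : ∀ a b → indicator (a ∨ b) + indicator (a ∧ b) ≡ indicator a + indicator b
  pointwise true  true  = refl
  pointwise true  false = refl
  pointwise false true  = refl
  pointwise false false = refl

count-∨-≤ : ∀ {n} (p q : Fin n → Bool) → count (λ i → p i ∨ q i) ≤ count p + count q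
count-∨-≤ p q = begin
  count (λ i → p i ∨ q i)                              ≤⟨ m≤m+n _ _ ⟩
  count (λ i → p i ∨ q i) + count (λ i → p i ∧ q i)    ≡⟨ count-∨-∧ p q ⟩
  count p + count q                                    ∎
  where open ≤-Reasoning

count-∨-< : ∀ {n} (p q : Fin n → Bool) {j} → p j ≡ true → q j ≡ true →
            count (λ i → p i ∨ q i) < count p + count q
count-∨-< p q {j} pj qj = begin-strict
  count (λ i → p i ∨ q i)                              <⟨ m<m+n _ (count-pos (λ i → p i ∧ q i) (cong₂ _∧_ pj qj)) ⟩
  count (λ i → p i ∨ q i) + count (λ i → p i ∧ q i)    ≡⟨ count-∨-∧ p q ⟩
  count p + count q                                    ∎
  where open ≤-Reasoning

count-∨-disjoint : ∀ {n} (p q : Fin n → Bool) → (∀ i → p i ∧ q i ≡ false) →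
                   count (λ i → p i ∨ q i) ≡ count p + count q
count-∨-disjoint {n} p q disjoint = begin
  count (λ i → p i ∨ q i)                              ≡⟨ +-identityʳ _ ⟨
  count (λ i → p i ∨ q i) + 0                          ≡⟨ cong (count (λ i → p i ∨ q i) +_) (trans (count-cong _ _ disjoint) (count-false {n})) ⟨
  count (λ i → p i ∨ q i) + count (λ i → p i ∧ q i)    ≡⟨ count-∨-∧ p q ⟩
  count p + count q                                    ∎
  where open ≡-Reasoning

count-⊆ : ∀ {n} (p q : Fin n → Bool) → (∀ i → p i ≡ true → q i ≡ true) →
          count q ≡ count p + count (λ i → q i ∧ not (p i))
count-⊆ {n} p q p⊆q = begin
  count q                                        ≡⟨ +-identityʳ _ ⟨
  count q + 0                                    ≡⟨ cong (count q +_) (count-false {n}) ⟨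
  count q + count {n} (λ _ → false)              ≡⟨ count-+ _ _ _ _ (λ i → pointwise (p i) (q i) (p⊆q i)) ⟩
  count p + count (λ i → q i ∧ not (p i))        ∎
  where
  open ≡-Reasoning
  pointwise : ∀ a b → (a ≡ true → b ≡ true) →
              indicator b + 0 ≡ indicator a + indicator (b ∧ not a)
  pointwise true  true  _   = refl
  pointwise false true  _   = refl
  pointwise false false _   = refl
  pointwise true  false a⇒b with () ← a⇒b refl

count-mono : ∀ {n} (p q : Fin n → Bool) → (∀ i → p i ≡ true → q i ≡ true) → count p ≤ count q
count-mono p q p⊆q = ≤-trans (m≤m+n _ _) (≤-reflexive (sym (count-⊆ p q p⊆q)))

count-strict-mono : ∀ {n} (p q : Fin n → Bool) → (∀ i → p i ≡ true → q i ≡ true) →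
                    ∀ {j} → q j ≡ true → p j ≡ false → count p < count q
count-strict-mono p q p⊆q qj pj = ≤-trans
  (m<m+n _ (count-pos (λ i → q i ∧ not (p i)) (cong₂ (λ a b → a ∧ not b) qj pj)))
  (≤-reflexive (sym (count-⊆ p q p⊆q)))

count-<⇒∃ : ∀ {n} (p q : Fin n → Bool) → count q < count p → ∃ λ i → p i ≡ true × q i ≡ false
count-<⇒∃ p q q<p with any? (λ i → (p i Bool.≟ true) ×-dec (q i Bool.≟ false))
... | yes witness = witness
... | no  ¬∃      = ⊥-elim (<⇒≱ q<p (count-mono p q p⊆q))
  where
  p⊆q : ∀ i → p i ≡ true → q i ≡ true
  p⊆q i pi with q i in qi
  ... | true  = refl
  ... | false = ⊥-elim (¬∃ (i , pi , qi))

count-not : ∀ {n} (p : Fin n → Bool) → count p + count (λ i → not (p i)) ≡ n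
count-not {n} p = begin
  count p + count (λ i → not (p i))              ≡⟨ count-+ _ _ _ _ (λ i → pointwise (p i)) ⟩
  count {n} (λ _ → true) + count {n} (λ _ → false) ≡⟨ cong₂ _+_ (count-true {n}) (count-false {n}) ⟩
  n + 0                                          ≡⟨ +-identityʳ n ⟩
  n                                              ∎
  where
  open ≡-Reasoning
  pointwise : ∀ a → indicator a + indicator (not a) ≡ 1 + 0
  pointwise true  = refl
  pointwise false = refl

count<n⇒∃false : ∀ {n} (p : Fin n → Bool) → count p < n → ∃ λ i → p i ≡ false
count<n⇒∃false {n} p p<n with count-<⇒∃ (λ _ → true) p (subst (count p <_) (sym (count-true {n})) p<n)
... | i , _ , pi = i , pi

-- Swapping two images of a permutation

swap : ∀ {n} → Permutation n n → Fin n → Fin n → Permutation n n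
swap f a b = transpose a b ∘ₚ f

module _ {n} (f : Permutation n n) (a b : Fin n) where

  swap-at₁ : swap f a b ⟨$⟩ʳ a ≡ f ⟨$⟩ʳ b
  swap-at₁ rewrite dec-true (a ≟ a) refl = refl

  swap-at₂ : swap f a b ⟨$⟩ʳ b ≡ f ⟨$⟩ʳ a
  swap-at₂ with b ≟ a
  ... | yes refl = refl
  ... | no  _    rewrite dec-true (b ≟ b) refl = refl

  swap-elsewhere : ∀ {k} → k ≢ a → k ≢ b → swap f a b ⟨$⟩ʳ k ≡ f ⟨$⟩ʳ k
  swap-elsewhere {k} k≢a k≢b rewrite dec-false (k ≟ a) k≢a | dec-false (k ≟ b) k≢b = refl

permutation-through₂ : ∀ {n} {l₁ l₂ r₁ r₂ : Fin n} → l₁ ≢ l₂ → r₁ ≢ r₂ →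
                       Σ (Permutation n n) λ f → f ⟨$⟩ʳ l₁ ≡ r₁ × f ⟨$⟩ʳ l₂ ≡ r₂
permutation-through₂ {l₁ = l₁} {l₂} {r₁} {r₂} l₁≢l₂ r₁≢r₂ =
  swap π l₂ k , trans (swap-elsewhere π l₂ k l₁≢l₂ l₁≢k) πl₁ , trans (swap-at₁ π l₂ k) (inverseʳ π)
  where
  π = swap id l₁ r₁
  k = π ⟨$⟩ˡ r₂
  πl₁ : π ⟨$⟩ʳ l₁ ≡ r₁
  πl₁ = swap-at₁ id l₁ r₁
  l₁≢k : l₁ ≢ k
  l₁≢k l₁≡k = r₁≢r₂ (trans (sym πl₁) (trans (cong (π ⟨$⟩ʳ_) l₁≡k) (inverseʳ π)))

module SwapRepair {n} (A : BipGraph n) (target : Fin n → Bool) (Inv : Permutation n n → Set) where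

  misplaced : Permutation n n → Fin n → Bool
  misplaced f l = target l ∧ not (A l (f ⟨$⟩ʳ l))

  Placed : Permutation n n → Set
  Placed f = ∀ l → target l ≡ true → A l (f ⟨$⟩ʳ l) ≡ true

  record Repair (f : Permutation n n) (l : Fin n) : Set where
    field
      partner        : Fin n
      partner≢l      : partner ≢ l
      l-placed       : A l (f ⟨$⟩ʳ partner) ≡ true
      partner-placed : target partner ≡ false ⊎ A partner (f ⟨$⟩ʳ l) ≡ true
      invariant      : Inv (swap f l partner)

  Repairable : Set
  Repairable = ∀ f → Inv f → ∀ l → target l ≡ true → A l (f ⟨$⟩ʳ l) ≡ false → Repair f l

  repair-decreases : ∀ {f l} → target l ≡ true → A l (f ⟨$⟩ʳ l) ≡ false → (r : Repair f l) →
                     count (misplaced (swap f l (Repair.partner r))) < count (misplaced f)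
  repair-decreases {f} {l} target-l unplaced-l r =
    count-strict-mono (misplaced g) (misplaced f) stays-misplaced misplaced-l now-placed-l
    where
    open Repair r
    g = swap f l partner
    misplaced-l : misplaced f l ≡ true
    misplaced-l = cong₂ (λ t a → t ∧ not a) target-l unplaced-l
    now-placed-l : misplaced g l ≡ false
    now-placed-l = begin
      target l ∧ not (A l (g ⟨$⟩ʳ l))        ≡⟨ cong (λ a → target l ∧ not a) (trans (cong (A l) (swap-at₁ f l partner)) l-placed) ⟩
      target l ∧ false                       ≡⟨ Bool.∧-zeroʳ (target l) ⟩
      false                                  ∎
      where open ≡-Reasoning
    now-placed-partner : misplaced g partner ≡ false
    now-placed-partner with partner-placed
    ... | inj₁ untargeted = cong (λ t → t ∧ not (A partner (g ⟨$⟩ʳ partner))) untargeted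
    ... | inj₂ placed     = trans
      (cong (λ a → target partner ∧ not a) (trans (cong (A partner) (swap-at₂ f l partner)) placed))
      (Bool.∧-zeroʳ (target partner))
    stays-misplaced : ∀ i → misplaced g i ≡ true → misplaced f i ≡ true
    stays-misplaced i = by-cases (i ≟ l) (i ≟ partner)
      where
      by-cases : Dec (i ≡ l) → Dec (i ≡ partner) → misplaced g i ≡ true → misplaced f i ≡ true
      by-cases (yes refl) _          m with () ← trans (sym now-placed-l) m
      by-cases (no _)     (yes refl) m with () ← trans (sym now-placed-partner) m
      by-cases (no i≢l)   (no i≢p)   m =
        trans (cong (λ r → target i ∧ not (A i r)) (sym (swap-elsewhere f l partner i≢l i≢p))) m

  repair-all : Repairable → ∀ f → Inv f → Σ (Permutation n n) λ g → Inv g × Placed g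
  repair-all repairable f inv = go (suc (count (misplaced f))) f inv ≤-refl
    where
    go : ∀ k f → Inv f → count (misplaced f) < k → Σ (Permutation n n) λ g → Inv g × Placed g
    go k f inv bound with any? (λ l → misplaced f l Bool.≟ true)
    ... | no none = f , inv , placed
      where
      placed : Placed f
      placed l target-l with A l (f ⟨$⟩ʳ l) in fl
      ... | true  = refl
      ... | false = ⊥-elim (none (l , cong₂ (λ t a → t ∧ not a) target-l fl))
    go (suc k) f inv bound | yes (l , m) =
      go k (swap f l (Repair.partner r)) (Repair.invariant r)
         (≤-trans (repair-decreases target-l unplaced-l r) (≤-pred bound))
      where
      target-l    = Bool.∧-conicalˡ _ _ m
      unplaced-l  = Bool.not-injective (Bool.∧-conicalʳ _ _ m)
      r = repairable f inv l target-l unplaced-l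

-- Bipartite graphs and perfect matchings

∁ : ∀ {n} → BipGraph n → BipGraph n
∁ A l r = not (A l r)

_∪_ : ∀ {n} → BipGraph n → BipGraph n → BipGraph n
(A ∪ B) l r = A l r ∨ B l r

_∖_ : ∀ {n} → BipGraph n → BipGraph n → BipGraph n
(A ∖ B) l r = A l r ∧ not (B l r)

Disjoint : ∀ {n} → BipGraph n → BipGraph n → Set
Disjoint {n} A B = ∀ (l r : Fin n) → A l r ∧ B l r ≡ false

edges : ∀ {n} → Permutation n n → BipGraph n
edges f l r = (f ⟨$⟩ʳ l) == r

record PerfectMatchingOf {n} (A : BipGraph n) (f : Permutation n n) : Set where
  constructor perfectMatching
  field matched : ∀ l → A l (f ⟨$⟩ʳ l) ≡ true
open PerfectMatchingOf

DegreeAtMost : ∀ {n} → ℕ → BipGraph n → Set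
DegreeAtMost {n} d A = (∀ (l : Fin n) → degL A l ≤ d) × (∀ (r : Fin n) → degR A r ≤ d)

regular⇒degreeAtMost : ∀ {n d} {A : BipGraph n} → Regular d A → DegreeAtMost d A
regular⇒degreeAtMost (rows , cols) = (λ l → ≤-reflexive (rows l)) , (λ r → ≤-reflexive (cols r))

regular-cong : ∀ {n d} {A B : BipGraph n} → (∀ l r → A l r ≡ B l r) → Regular d A → Regular d B
regular-cong {A = A} {B} A≗B (rows , cols) =
  (λ l → trans (count-cong (B l) (A l) λ r → sym (A≗B l r)) (rows l)) ,
  (λ r → trans (count-cong (λ l → B l r) (λ l → A l r) λ l → sym (A≗B l r)) (cols r))

∪-regular : ∀ {n a b} {A B : BipGraph n} → Regular a A → Regular b B → Disjoint A B →
            Regular (a + b) (A ∪ B)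
∪-regular {A = A} {B} (rowsA , colsA) (rowsB , colsB) disjoint =
  (λ l → trans (count-∨-disjoint (A l) (B l) (disjoint l)) (cong₂ _+_ (rowsA l) (rowsB l))) ,
  (λ r → trans (count-∨-disjoint (λ l → A l r) (λ l → B l r) (λ l → disjoint l r))
               (cong₂ _+_ (colsA r) (colsB r)))

∁-regular : ∀ {n d} {A : BipGraph n} → d ≤ n → Regular (n ∸ d) A → Regular d (∁ A)
∁-regular {n} {d} {A} d≤n (rows , cols) =
  (λ l → complement (A l) (rows l)) , (λ r → complement (λ l → A l r) (cols r))
  where
  complement : (p : Fin n → Bool) → count p ≡ n ∸ d → count (λ i → not (p i)) ≡ d
  complement p count-p = begin
    count (λ i → not (p i))                          ≡⟨ m+n∸m≡n (count p) _ ⟨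
    count p + count (λ i → not (p i)) ∸ count p      ≡⟨ cong₂ _∸_ (count-not p) count-p ⟩
    n ∸ (n ∸ d)                                      ≡⟨ m∸[m∸n]≡n d≤n ⟩
    d                                                ∎
    where open ≡-Reasoning

edges-regular : ∀ {n} (f : Permutation n n) → Regular 1 (edges f)
edges-regular f =
  (λ l → count-==ʳ (f ⟨$⟩ʳ l)) ,
  (λ r → trans (count-permute (_== r) f) (count-==ˡ r))

edges-subgraph : ∀ {n} {A : BipGraph n} {f} → PerfectMatchingOf A f → Subgraph (edges f) A
edges-subgraph {A = A} matching l r fl≡r = subst (λ r → A l r ≡ true) (==⇒≡ fl≡r) (matched matching l)

∁-∖-perfectMatching : ∀ {n d} {A : BipGraph n} {f} → Regular d (∁ A) → PerfectMatchingOf A f →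
                       Regular (d + 1) (∁ (A ∖ edges f))
∁-∖-perfectMatching {A = A} {f} regular matching =
  regular-cong de-Morgan (∪-regular regular (edges-regular f) disjoint)
  where
  de-Morgan : ∀ l r → (∁ A ∪ edges f) l r ≡ ∁ (A ∖ edges f) l r
  de-Morgan l r with A l r | edges f l r
  ... | true  | true  = refl
  ... | true  | false = refl
  ... | false | true  = refl
  ... | false | false = refl
  disjoint : Disjoint (∁ A) (edges f)
  disjoint l r with edges f l r in fl≡r
  ... | false = Bool.∧-zeroʳ _
  ... | true  = cong (λ a → not a ∧ true) (edges-subgraph matching l r fl≡r)

-- Perfect matchings through prescribed edges

module _ {n} (A : BipGraph n) (f : Permutation n n) where

  blocked : Fin n → Fin n → Bool
  blocked l i = not (A l (f ⟨$⟩ʳ i)) ∨ not (A i (f ⟨$⟩ʳ l))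

  count-blocked : ∀ {d l} → DegreeAtMost d (∁ A) → A l (f ⟨$⟩ʳ l) ≡ false → count (blocked l) < d + d
  count-blocked {d} {l} sparse unplaced = begin-strict
    count (blocked l)                     <⟨ count-∨-< l-rejects rejects-fl (cong not unplaced) (cong not unplaced) ⟩
    count l-rejects + count rejects-fl    ≡⟨ cong (_+ count rejects-fl) (count-permute (∁ A l) f) ⟩
    degL (∁ A) l + degR (∁ A) (f ⟨$⟩ʳ l)  ≤⟨ +-mono-≤ (proj₁ sparse l) (proj₂ sparse (f ⟨$⟩ʳ l)) ⟩
    d + d                                 ∎
    where
    open ≤-Reasoning
    l-rejects rejects-fl : Fin n → Bool
    l-rejects  i = not (A l (f ⟨$⟩ʳ i))
    rejects-fl i = not (A i (f ⟨$⟩ʳ l))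

  unblocked : ∀ {l i} → blocked l i ≡ false → A l (f ⟨$⟩ʳ i) ≡ true × A i (f ⟨$⟩ʳ l) ≡ true
  unblocked b = Bool.not-injective (Bool.∨-conicalˡ _ _ b) , Bool.not-injective (Bool.∨-conicalʳ _ _ b)

perfectMatching-through₂ : ∀ {n d} (A : BipGraph n) → DegreeAtMost d (∁ A) → suc (d + d) < n →
  ∀ {l₁ l₂ r₁ r₂} → l₁ ≢ l₂ → r₁ ≢ r₂ → A l₁ r₁ ≡ true → A l₂ r₂ ≡ true →
  Σ (Permutation n n) λ f → PerfectMatchingOf A f × f ⟨$⟩ʳ l₁ ≡ r₁ × f ⟨$⟩ʳ l₂ ≡ r₂
perfectMatching-through₂ {n} {d} A sparse d+d+1<n {l₁} {l₂} {r₁} {r₂} l₁≢l₂ r₁≢r₂ A₁ A₂ =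
  f , perfectMatching (λ l → placed l refl) , fixes
  where
  Fixes : Permutation n n → Set
  Fixes f = f ⟨$⟩ʳ l₁ ≡ r₁ × f ⟨$⟩ʳ l₂ ≡ r₂

  open SwapRepair A (λ _ → true) Fixes

  repairable : Repairable
  repairable f (f₁ , f₂) l _ unplaced = record
    { partner        = l'
    ; partner≢l      = λ l'≡l → true≢false (subst (λ k → A l (f ⟨$⟩ʳ k) ≡ true) l'≡l Alfl') unplaced
    ; l-placed       = Alfl'
    ; partner-placed = inj₂ Al'fl
    ; invariant      = keep l₁ f₁ A₁ (==false⇒≢ l'≠l₁ ∘ sym) , keep l₂ f₂ A₂ (==false⇒≢ l'≠l₂ ∘ sym)
    }
    where
    fixed excluded : Fin n → Bool
    fixed    i = (i == l₁) ∨ (i == l₂)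
    excluded i = blocked A f l i ∨ fixed i
    count-fixed : count fixed ≤ 2
    count-fixed = ≤-trans (count-∨-≤ (_== l₁) (_== l₂)) (≤-reflexive (cong₂ _+_ (count-==ˡ l₁) (count-==ˡ l₂)))
    few-excluded : count excluded < n
    few-excluded = begin-strict
      count excluded                       ≤⟨ count-∨-≤ (blocked A f l) fixed ⟩
      count (blocked A f l) + count fixed  <⟨ +-mono-<-≤ (count-blocked A f sparse unplaced) count-fixed ⟩
      d + d + 2                            ≡⟨ +-comm (d + d) 2 ⟩
      suc (suc (d + d))                    ≤⟨ d+d+1<n ⟩
      n                                    ∎
      where open ≤-Reasoning
    witness = count<n⇒∃false excluded few-excluded
    l' = proj₁ witness
    l'∉fixed : fixed l' ≡ false
    l'∉fixed = Bool.∨-conicalʳ (blocked A f l l') _ (proj₂ witness)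
    l'≠l₁ : (l' == l₁) ≡ false
    l'≠l₁ = Bool.∨-conicalˡ _ (l' == l₂) l'∉fixed
    l'≠l₂ : (l' == l₂) ≡ false
    l'≠l₂ = Bool.∨-conicalʳ (l' == l₁) _ l'∉fixed
    Alfl' = proj₁ (unblocked A f (Bool.∨-conicalˡ _ _ (proj₂ witness)))
    Al'fl = proj₂ (unblocked A f (Bool.∨-conicalˡ _ _ (proj₂ witness)))
    keep : ∀ k {r} → f ⟨$⟩ʳ k ≡ r → A k r ≡ true → k ≢ l' → swap f l l' ⟨$⟩ʳ k ≡ r
    keep k fk≡r Akr k≢l' = trans (swap-elsewhere f l l' k≢l k≢l') fk≡r
      where
      k≢l : k ≢ l
      k≢l refl = true≢false (subst (λ r → A k r ≡ true) (sym fk≡r) Akr) unplaced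

  start = permutation-through₂ l₁≢l₂ r₁≢r₂
  repaired = repair-all repairable (proj₁ start) (proj₂ start)
  f = proj₁ repaired
  fixes = proj₁ (proj₂ repaired)
  placed = proj₂ (proj₂ repaired)

-- For d = 3 and n = 6 the count above leaves no room to exclude l₀ as a partner.  Instead the
-- neighbours of r₀ are placed first, each against a non-neighbour of r₀ (there are at least d,
-- and l, which rejects its own image, rejects at most d − 1 of them); afterwards a misplaced l
-- is not a neighbour of r₀, so l₀, being matched to r₀, is blocked for l and never moves.
perfectMatching-through : ∀ {n d} (A : BipGraph n) → DegreeAtMost d (∁ A) → d + d ≤ n →
  ∀ {l₀ r₀} → A l₀ r₀ ≡ true → d ≤ degR (∁ A) r₀ →
  Σ (Permutation n n) λ f → PerfectMatchingOf A f × f ⟨$⟩ʳ l₀ ≡ r₀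
perfectMatching-through {n} {d} A sparse d+d≤n {l₀} {r₀} A₀ d≤degR =
  f , perfectMatching (λ l → placed l refl) , proj₁ invariant
  where
  Fixes : Permutation n n → Set
  Fixes f = f ⟨$⟩ʳ l₀ ≡ r₀

  module Neighbours = SwapRepair A (λ l → A l r₀) Fixes

  neighbours-repairable : Neighbours.Repairable
  neighbours-repairable f f₀ l Alr₀ unplaced = record
    { partner        = l'
    ; partner≢l      = λ l'≡l → true≢false Alr₀ (subst (λ k → A k r₀ ≡ false) l'≡l Al'r₀)
    ; l-placed       = Bool.not-injective unfit-l'
    ; partner-placed = inj₁ Al'r₀
    ; invariant      = trans (swap-elsewhere f l l' l₀≢l l₀≢l') f₀
    }
    where
    missing unfit : Fin n → Bool
    missing i = not (A i r₀)
    unfit i = not (A l (f ⟨$⟩ʳ i))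
    fewer : count (λ i → missing i ∧ unfit i) < count missing
    fewer = begin-strict
      count (λ i → missing i ∧ unfit i)  <⟨ count-strict-mono _ unfit (λ i → Bool.∧-conicalʳ _ _)
                                                 (cong not unplaced) (cong (λ a → not a ∧ unfit l) Alr₀) ⟩
      count unfit                          ≡⟨ count-permute (∁ A l) f ⟩
      degL (∁ A) l                         ≤⟨ proj₁ sparse l ⟩
      d                                    ≤⟨ d≤degR ⟩
      count missing                        ∎
      where open ≤-Reasoning
    witness = count-<⇒∃ missing (λ i → missing i ∧ unfit i) fewer
    l' = proj₁ witness
    Al'r₀ : A l' r₀ ≡ false
    Al'r₀ = Bool.not-injective (proj₁ (proj₂ witness))
    unfit-l' : unfit l' ≡ false
    unfit-l' = trans (cong (_∧ unfit l') (sym (proj₁ (proj₂ witness)))) (proj₂ (proj₂ witness))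
    l₀≢l : l₀ ≢ l
    l₀≢l refl = true≢false (subst (λ r → A l₀ r ≡ true) (sym f₀) A₀) unplaced
    l₀≢l' : l₀ ≢ l'
    l₀≢l' refl = true≢false A₀ Al'r₀

  neighbours-placed = Neighbours.repair-all neighbours-repairable (swap id l₀ r₀) (swap-at₁ id l₀ r₀)

  Invariant : Permutation n n → Set
  Invariant f = Fixes f × Neighbours.Placed f

  open SwapRepair A (λ _ → true) Invariant

  repairable : Repairable
  repairable f (f₀ , neighbours-ok) l _ unplaced = record
    { partner        = l'
    ; partner≢l      = λ l'≡l → true≢false (subst (λ k → A l (f ⟨$⟩ʳ k) ≡ true) l'≡l Alfl') unplaced
    ; l-placed       = Alfl'
    ; partner-placed = inj₂ Al'fl
    ; invariant      = trans (swap-elsewhere f l l' l₀≢l l₀≢l') f₀ , neighbours-ok′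
    }
    where
    witness = count<n⇒∃false (blocked A f l) (≤-trans (count-blocked A f sparse unplaced) d+d≤n)
    l' = proj₁ witness
    Alfl' = proj₁ (unblocked A f (proj₂ witness))
    Al'fl = proj₂ (unblocked A f (proj₂ witness))
    Alr₀ : A l r₀ ≡ false
    Alr₀ with A l r₀ in e
    ... | true  = ⊥-elim (true≢false (neighbours-ok l e) unplaced)
    ... | false = refl
    l₀≢l : l₀ ≢ l
    l₀≢l refl = true≢false (subst (λ r → A l₀ r ≡ true) (sym f₀) A₀) unplaced
    l₀≢l' : l₀ ≢ l'
    l₀≢l' refl = true≢false (subst (λ r → A l r ≡ true) f₀ Alfl') Alr₀
    neighbours-ok′ : Neighbours.Placed (swap f l l')
    neighbours-ok′ k Akr₀ = by-cases (k ≟ l) (k ≟ l')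
      where
      by-cases : Dec (k ≡ l) → Dec (k ≡ l') → A k (swap f l l' ⟨$⟩ʳ k) ≡ true
      by-cases (yes refl) _          = ⊥-elim (true≢false Akr₀ Alr₀)
      by-cases (no _)     (yes refl) = trans (cong (A k) (swap-at₂ f l k)) Al'fl
      by-cases (no k≢l)   (no k≢l')  = trans (cong (A k) (swap-elsewhere f l l' k≢l k≢l')) (neighbours-ok k Akr₀)

  repaired = repair-all repairable (proj₁ neighbours-placed) (proj₂ neighbours-placed)
  f = proj₁ repaired
  invariant = proj₁ (proj₂ repaired)
  placed = proj₂ (proj₂ repaired)

edges-∋ : ∀ {n} (f : Permutation n n) {l r} → f ⟨$⟩ʳ l ≡ r → edges f l r ≡ true
edges-∋ f {l} refl = ==-refl (f ⟨$⟩ʳ l)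

∪-∋ˡ : ∀ {n} (A B : BipGraph n) {l r} → A l r ≡ true → (A ∪ B) l r ≡ true
∪-∋ˡ A B {l} {r} Alr = cong (_∨ B l r) Alr

∪-∋ʳ : ∀ {n} (A B : BipGraph n) {l r} → B l r ≡ true → (A ∪ B) l r ≡ true
∪-∋ʳ A B {l} {r} Blr = trans (cong (A l r ∨_) Blr) (Bool.∨-zeroʳ (A l r))

∖-edges-∋ : ∀ {n} {A : BipGraph n} (f : Permutation n n) {l r} → A l r ≡ true → f ⟨$⟩ʳ l ≢ r →
            (A ∖ edges f) l r ≡ true
∖-edges-∋ f Alr fl≢r = cong₂ (λ a b → a ∧ not b) Alr (≢⇒==false fl≢r)

twoFactor-∪ : ∀ {n} {E : BipGraph n} {f₁ f₂} → PerfectMatchingOf E f₁ →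
              PerfectMatchingOf (E ∖ edges f₁) f₂ → TwoFactor (edges f₁ ∪ edges f₂) E
twoFactor-∪ {E = E} {f₁} {f₂} M₁ M₂ =
  subgraph , ∪-regular (edges-regular f₁) (edges-regular f₂) disjoint
  where
  subgraph : Subgraph (edges f₁ ∪ edges f₂) E
  subgraph l r e with edges f₁ l r in e₁
  ... | true  = edges-subgraph M₁ l r e₁
  ... | false = Bool.∧-conicalˡ _ _ (edges-subgraph M₂ l r e)
  disjoint : Disjoint (edges f₁) (edges f₂)
  disjoint l r with edges f₂ l r in e₂
  ... | false = Bool.∧-zeroʳ _
  ... | true  = trans (Bool.∧-identityʳ _)
                  (Bool.not-injective (Bool.∧-conicalʳ _ _ (edges-subgraph M₂ l r e₂)))

proposition2 : (n : ℕ) → 6 ≤ n → (E : BipGraph n) → Regular (n ∸ 2) E →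
    (P : Path3 E) → Σ (BipGraph n) (λ F → TwoFactor F E × ContainsPath F P)
proposition2 n 6≤n E regular P =
  let f₁ , M₁ , f₁l₁ , f₁l₂ = perfectMatching-through₂ E (regular⇒degreeAtMost ∁E-regular) 6≤n
                                  l₁≢l₂ r₁≢r₂ e₁ e₃
      ∁E′-regular = ∁-∖-perfectMatching ∁E-regular M₁
      f₂ , M₂ , f₂l₂ = perfectMatching-through (E ∖ edges f₁) (regular⇒degreeAtMost ∁E′-regular) 6≤n
                         (∖-edges-∋ {A = E} f₁ e₂ λ f₁l₂≡r₁ → r₁≢r₂ (trans (sym f₁l₂≡r₁) f₁l₂))
                         (≤-reflexive (sym (proj₂ ∁E′-regular r₁)))
      F = edges f₁ ∪ edges f₂
  in F , twoFactor-∪ M₁ M₂ ,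
     ∪-∋ˡ (edges f₁) (edges f₂) (edges-∋ f₁ f₁l₁) ,
     ∪-∋ʳ (edges f₁) (edges f₂) (edges-∋ f₂ f₂l₂) ,
     ∪-∋ˡ (edges f₁) (edges f₂) (edges-∋ f₁ f₁l₂)
  where
  open Path3 P
  ∁E-regular : Regular 2 (∁ E)
  ∁E-regular = ∁-regular (≤-trans (s≤s (s≤s z≤n)) 6≤n) regular
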